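{- For every accuracy $\delta$ with $\frac{41}{43}<\delta\le 1$, there is no online algorithm for Online Bin Packing with Estimated Item Sizes with accuracy $\delta$ that is $c$-competitive for some $c<\frac{3}{2}$.
   Context: Online Bin Packing with Estimated Item Sizes: an input is a list $L=a_1,\dots,a_n$ of items. Before any item is revealed, the algorithm receives the accuracy $\delta\in(0,1]$ and an estimated size $c'(a)\in(0,1]$ for every item $a\in L$. The items are then revealed one by one together with their actual sizes $c(a)$, where $c(a)\in[c'(a)(1-\delta),\min(c'(a)(1+\delta),1)]$; each item must be irrevocably assigned to a bin of capacity $1$ (total size of items in a bin at most $1$) before the next item is revealed. The goal is to minimize the number of bins used. $A(L)$ denotes the number of bins used by algorithm $A$ on $L$ and $OPT(L)$ the minimum number of bins in any packing of $L$. An algorithm $A$ is $c$-competitive if there is a constant $K$ such that $A(L)\le c\cdot OPT(L)+K$ for every input list $L$.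
   Formalization: The accuracy δ, the competitive ratio c and the constant K are rational, and the estimated and actual item sizes are taken in ℚ as well. -}

module Defs where

open import Data.Nat as ℕ using (ℕ)
open import Data.Integer using (+_)
open import Data.Fin using (Fin)
open import Data.Vec using (Vec; lookup)
open import Data.List using (List; []; _∷_; _++_; [_]; map; length; zip; deduplicate; allFin)
open import Data.List.Relation.Unary.All using (All)
open import Data.List.Relation.Binary.Permutation.Propositional using (_↭_)
open import Data.Rational using (ℚ; 0ℚ; 1ℚ; _+_; _-_; _*_; _≤_; _<_; _⊓_; _/_)
open import Data.Product using (Σ; _×_; _,_; proj₁; proj₂; ∃)
open import Relation.Nullary using (yes; no)

toℚ : ℕ → ℚ
toℚ n = + n / 1

-- An instance: n items with estimated sizes `est` (indexed by labels Fin n),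
-- and an arrival sequence: the items (by label) in the order they are
-- revealed, each together with its actual size.
record Instance : Set where
  constructor inst
  field
    n       : ℕ
    est     : Vec ℚ n
    arrival : List (Fin n × ℚ)

open Instance public

sizes : Instance → List ℚ
sizes I = map proj₂ (arrival I)

Admissible : ℚ → Instance → Set
Admissible δ (inst n e arr) =
  All (λ x → (0ℚ < x) × (x ≤ 1ℚ)) (Data.Vec.toList e)
  × (map proj₁ arr ↭ allFin n)
  × All (λ p → (lookup e (proj₁ p) * (1ℚ - δ) ≤ proj₂ p)
               × (proj₂ p ≤ (lookup e (proj₁ p) * (1ℚ + δ)) ⊓ 1ℚ)) arr

-- A deterministic online algorithm: given the accuracy δ, the number n of
-- items, all estimated sizes (known in advance), and the history of revealed
-- items (label, actual size) so far, the last entry being the current item,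
-- it returns the (index of the) bin into which the current item is put.
OnlineAlg : Set
OnlineAlg = ℚ → (n : ℕ) → Vec ℚ n → List (Fin n × ℚ) → ℕ

runFrom : OnlineAlg → ℚ → (n : ℕ) → Vec ℚ n →
          List (Fin n × ℚ) → List (Fin n × ℚ) → List ℕ
runFrom A δ n e hist [] = []
runFrom A δ n e hist (x ∷ xs) =
  A δ n e (hist ++ [ x ]) ∷ runFrom A δ n e (hist ++ [ x ]) xs

run : OnlineAlg → ℚ → Instance → List ℕ
run A δ (inst n e arr) = runFrom A δ n e [] arr

load : List (ℚ × ℕ) → ℕ → ℚ
load [] b = 0ℚ
load ((s , b') ∷ ps) b with b' ℕ.≟ b
... | yes _ = s + load ps b
... | no  _ = load ps b

Feasible : List (ℚ × ℕ) → Set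
Feasible ps = ∀ b → load ps b ≤ 1ℚ

PackableIn : List ℚ → ℕ → Set
PackableIn ss m =
  Σ (List ℕ) λ bs → (length bs ≡ length ss) × All (λ b → b ℕ.< m) bs × Feasible (zip ss bs)
  where open import Relation.Binary.PropositionalEquality using (_≡_)

IsOPT : List ℚ → ℕ → Set
IsOPT ss m = PackableIn ss m × (∀ m' → PackableIn ss m' → m ℕ.≤ m')

numBins : OnlineAlg → ℚ → Instance → ℕ
numBins A δ I = length (deduplicate ℕ._≟_ (run A δ I))

Competitive : ℚ → OnlineAlg → ℚ → Set
Competitive δ A c =
  ∃ λ (K : ℚ) → ∀ (I : Instance) → Admissible δ I →
    Feasible (zip (sizes I) (run A δ I))
    × (∀ m → IsOPT (sizes I) m → toℚ (numBins A δ I) ≤ c * toℚ m + K)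

-- Three phases of 6M items each are revealed: items of size 61/420, then 141/420, then
-- 211/420, all announced with estimates 43/84 of their size.  Because δ > 41/43, each
-- phase may also consist of tiny items with the same estimates, and the instances that
-- stop after the first or the second phase (tiny items afterwards) need only M and 3M
-- bins, while the full instance needs 6M.  An online algorithm cannot tell these
-- instances apart until the phase ends.  A bin receiving c₁, c₂, c₃ items of the three
-- phases satisfies c₁ + 2c₂ + 2c₃ ≤ 2(number of phases after which it is nonempty), so
-- summing over bins, 30M ≤ 2(A(L₁) + A(L₂) + A(L₃)), whereas a c-competitive algorithm
-- has A(L₁) + A(L₂) + A(L₃) ≤ c(M + 3M + 6M) + 3K, which fails for large M when c < 3/2.
module Submission where

open import Defs
open import Data.Integer using (+_)
open import Data.Rational using (ℚ; 1ℚ; _≤_; _<_; _/_)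
open import Relation.Nullary using (¬_)

open import Data.Empty using (⊥)
open import Data.Fin using (Fin; toℕ)
import Data.Fin as Fin
import Data.Integer as ℤ
import Data.Integer.Properties as ℤP
open import Data.List as List
  using (List; []; _∷_; _++_; [_]; length; filter; deduplicate; replicate; take; drop; zip; applyUpTo)
import Data.List.Properties as ListP
open import Data.List.Relation.Unary.All using (All; [])
import Data.List.Relation.Unary.All.Properties as AllP
open import Data.List.Relation.Binary.Permutation.Propositional using (↭-reflexive)
open import Data.Nat as ℕ using (ℕ; zero; suc; z≤n; s≤s)
import Data.Nat.Coprimality as Coprime
import Data.Nat.Properties as ℕP
open import Data.Nat.Solver using (module +-*-Solver)
open import Data.Product using (Σ; _×_; _,_; proj₁; proj₂)
import Data.Rational as ℚ
import Data.Rational.Properties as ℚP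
open import Data.Rational.Solver renaming (module +-*-Solver to ℚ-Solver)
open import Data.Sum using (inj₁; inj₂)
import Data.Vec as Vec
import Data.Vec.Properties as VecP
import Data.Vec.Relation.Unary.All.Properties as VecAllP
open import Relation.Binary.PropositionalEquality
  using (_≡_; _≢_; refl; sym; trans; cong; cong₂; subst; subst₂; module ≡-Reasoning)
open import Relation.Nullary using (Dec; yes; no; ¬?; contradiction)
open import Relation.Nullary.Decidable using (toWitness; _→-dec_)

p≤p+q : ∀ {p q} → ℚ.0ℚ ≤ q → p ≤ p ℚ.+ q
p≤p+q {p} 0≤q = ℚP.≤-trans (ℚP.≤-reflexive (sym (ℚP.+-identityʳ p))) (ℚP.+-monoʳ-≤ p 0≤q)

p≤q+p : ∀ {p q} → ℚ.0ℚ ≤ q → p ≤ q ℚ.+ p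
p≤q+p {p} 0≤q = ℚP.≤-trans (ℚP.≤-reflexive (sym (ℚP.+-identityˡ p))) (ℚP.+-monoˡ-≤ p 0≤q)

0≤p+q : ∀ {p q} → ℚ.0ℚ ≤ p → ℚ.0ℚ ≤ q → ℚ.0ℚ ≤ p ℚ.+ q
0≤p+q 0≤p 0≤q = ℚP.≤-trans 0≤p (p≤p+q 0≤q)

toℚ-mkℚ : ∀ n → toℚ n ≡ ℚ.mkℚ (+ n) 0 (Coprime.sym (Coprime.1-coprimeTo n))
toℚ-mkℚ n = ℚP.normalize-coprime (Coprime.sym (Coprime.1-coprimeTo n))

toℚ-+ : ∀ m n → toℚ (m ℕ.+ n) ≡ toℚ m ℚ.+ toℚ n
toℚ-+ m n rewrite toℚ-mkℚ m | toℚ-mkℚ n =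
  ℚP./-cong (sym (trans (cong₂ ℤ._+_ (ℤP.*-identityʳ (+ m)) (ℤP.*-identityʳ (+ n))) (sym (ℤP.pos-+ m n)))) refl

toℚ-* : ∀ m n → toℚ (m ℕ.* n) ≡ toℚ m ℚ.* toℚ n
toℚ-* m n rewrite toℚ-mkℚ m | toℚ-mkℚ n = ℚP./-cong (ℤP.pos-* m n) refl

toℚ-nonNeg : ∀ n → ℚ.0ℚ ≤ toℚ n
toℚ-nonNeg n = ℚP.nonNegative⁻¹ (toℚ n) {{ℚP.normalize-nonNeg n 1}}

toℚ-mono-≤ : ∀ {m n} → m ℕ.≤ n → toℚ m ≤ toℚ n
toℚ-mono-≤ {m} {n} m≤n =
  subst (toℚ m ≤_) (trans (sym (toℚ-+ m (n ℕ.∸ m))) (cong toℚ (ℕP.m+[n∸m]≡n m≤n))) (p≤p+q (toℚ-nonNeg (n ℕ.∸ m)))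

<-toℚ-suc-∣numerator∣ : ∀ r → r < toℚ (suc ℤ.∣ ℚ.↥ r ∣)
<-toℚ-suc-∣numerator∣ r@(ℚ.mkℚ (+ k) d _) = subst (r <_) (sym (toℚ-mkℚ (suc k)))
  (ℚ.*<* (subst₂ ℤ._<_ (sym (ℤP.*-identityʳ (+ k))) (ℤP.pos-* (suc k) (suc d))
    (ℤ.+<+ (s≤s (ℕP.≤-trans (ℕP.m≤m*n k (suc d)) (ℕP.m≤n+m _ d))))))
<-toℚ-suc-∣numerator∣ r@(ℚ.mkℚ ℤ.-[1+ k ] d _) = subst (r <_) (sym (toℚ-mkℚ (suc (suc k)))) (ℚ.*<* ℤ.-<+)

archimedean : ∀ e → ℚ.0ℚ < e → ∀ y → Σ ℕ λ M → y < toℚ M ℚ.* e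
archimedean e 0<e y =
  M , subst (_< toℚ M ℚ.* e) y/e*e≡y (ℚP.*-monoˡ-<-pos e {{ℚ.positive 0<e}} (<-toℚ-suc-∣numerator∣ (y ℚ.* ℚ.1/ e)))
  where
  instance
    e≢0 : ℚ.NonZero e
    e≢0 = ℚP.pos⇒nonZero e {{ℚ.positive 0<e}}
  M = suc ℤ.∣ ℚ.↥ (y ℚ.* ℚ.1/ e) ∣
  y/e*e≡y : (y ℚ.* ℚ.1/ e) ℚ.* e ≡ y
  y/e*e≡y = trans (ℚP.*-assoc y (ℚ.1/ e) e) (trans (cong (y ℚ.*_) (ℚP.*-inverseˡ e)) (ℚP.*-identityʳ y))

copies : ℕ → ℚ → ℚ
copies zero    x = ℚ.0ℚ
copies (suc k) x = x ℚ.+ copies k x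

copies-nonNeg : ∀ {x} → ℚ.0ℚ ≤ x → ∀ k → ℚ.0ℚ ≤ copies k x
copies-nonNeg 0≤x zero    = ℚP.≤-refl
copies-nonNeg 0≤x (suc k) = 0≤p+q 0≤x (copies-nonNeg 0≤x k)

copies-monoˡ-≤ : ∀ {x} → ℚ.0ℚ ≤ x → ∀ {k l} → k ℕ.≤ l → copies k x ≤ copies l x
copies-monoˡ-≤ 0≤x {l = l} z≤n = copies-nonNeg 0≤x l
copies-monoˡ-≤ {x} 0≤x (s≤s k≤l) = ℚP.+-monoʳ-≤ x (copies-monoˡ-≤ 0≤x k≤l)

copies-monoʳ-≤ : ∀ {x y} → x ≤ y → ∀ k → copies k x ≤ copies k y
copies-monoʳ-≤ x≤y zero    = ℚP.≤-refl
copies-monoʳ-≤ x≤y (suc k) = ℚP.+-mono-≤ x≤y (copies-monoʳ-≤ x≤y k)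

copies-≤1⇒< : ∀ {x} m → ℚ.0ℚ ≤ x → 1ℚ < copies m x → ∀ {k} → copies k x ≤ 1ℚ → k ℕ.< m
copies-≤1⇒< m 0≤x overflow fits =
  ℕP.≰⇒> λ m≤k → ℚP.<-irrefl refl (ℚP.<-≤-trans overflow (ℚP.≤-trans (copies-monoˡ-≤ 0≤x m≤k) fits))

small medium large : ℚ
small  = + 61 / 420
medium = + 141 / 420
large  = + 211 / 420

binSize : ℕ → ℕ → ℕ → ℚ
binSize c₁ c₂ c₃ = copies c₁ small ℚ.+ (copies c₂ medium ℚ.+ copies c₃ large)

occupied : ℕ → ℕ
occupied zero    = 0
occupied (suc _) = 1

weight : ℕ → ℕ → ℕ → ℕ
weight c₁ c₂ c₃ = c₁ ℕ.+ (2 ℕ.* c₂ ℕ.+ 2 ℕ.* c₃)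

phasesOpen : ℕ → ℕ → ℕ → ℕ
phasesOpen c₁ c₂ c₃ = occupied c₁ ℕ.+ (occupied (c₁ ℕ.+ c₂) ℕ.+ occupied (c₁ ℕ.+ (c₂ ℕ.+ c₃)))

WeightBounded : ℕ → ℕ → ℕ → Set
WeightBounded c₁ c₂ c₃ = weight c₁ c₂ c₃ ℕ.≤ 2 ℕ.* phasesOpen c₁ c₂ c₃

fits⇒weightBounded? : ∀ c₁ c₂ c₃ → Dec (binSize c₁ c₂ c₃ ≤ 1ℚ → WeightBounded c₁ c₂ c₃)
fits⇒weightBounded? c₁ c₂ c₃ = binSize c₁ c₂ c₃ ℚP.≤? 1ℚ →-dec weight c₁ c₂ c₃ ℕP.≤? 2 ℕ.* phasesOpen c₁ c₂ c₃

fits⇒weightBounded-below : ∀ {c₁} → c₁ ℕ.< 7 → ∀ {c₂} → c₂ ℕ.< 3 → ∀ {c₃} → c₃ ℕ.< 2 →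
                           binSize c₁ c₂ c₃ ≤ 1ℚ → WeightBounded c₁ c₂ c₃
fits⇒weightBounded-below = toWitness {a? = ℕP.allUpTo? (λ c₁ → ℕP.allUpTo? (λ c₂ →
  ℕP.allUpTo? (fits⇒weightBounded? c₁ c₂) 2) 3) 7} _

-- A bin holds at most 6 small, 2 medium and 1 large items, which leaves a finite check.
fits⇒weightBounded : ∀ c₁ c₂ c₃ → binSize c₁ c₂ c₃ ≤ 1ℚ → WeightBounded c₁ c₂ c₃
fits⇒weightBounded c₁ c₂ c₃ fits = fits⇒weightBounded-below c₁<7 c₂<3 c₃<2 fits
  where
  0≤small : ℚ.0ℚ ≤ small
  0≤small = ℚP.≤ᵇ⇒≤ _
  0≤medium : ℚ.0ℚ ≤ medium
  0≤medium = ℚP.≤ᵇ⇒≤ _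
  0≤large : ℚ.0ℚ ≤ large
  0≤large = ℚP.≤ᵇ⇒≤ _
  c₁<7 : c₁ ℕ.< 7
  c₁<7 = copies-≤1⇒< 7 0≤small (toWitness {a? = 1ℚ ℚP.<? copies 7 small} _)
    (ℚP.≤-trans (p≤p+q (0≤p+q (copies-nonNeg 0≤medium c₂) (copies-nonNeg 0≤large c₃))) fits)
  c₂<3 : c₂ ℕ.< 3
  c₂<3 = copies-≤1⇒< 3 0≤medium (toWitness {a? = 1ℚ ℚP.<? copies 3 medium} _)
    (ℚP.≤-trans (ℚP.≤-trans (p≤p+q (copies-nonNeg 0≤large c₃)) (p≤q+p (copies-nonNeg 0≤small c₁))) fits)
  c₃<2 : c₃ ℕ.< 2
  c₃<2 = copies-≤1⇒< 2 0≤large (toWitness {a? = 1ℚ ℚP.<? copies 2 large} _)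
    (ℚP.≤-trans (ℚP.≤-trans (p≤q+p (copies-nonNeg 0≤medium c₂)) (p≤q+p (copies-nonNeg 0≤small c₁))) fits)

occurrences : ℕ → List ℕ → ℕ
occurrences b []       = 0
occurrences b (x ∷ xs) with x ℕ.≟ b
... | yes _ = suc (occurrences b xs)
... | no  _ = occurrences b xs

removeAll : ℕ → List ℕ → List ℕ
removeAll a = filter (λ y → ¬? (a ℕ.≟ y))

distinct : List ℕ → ℕ
distinct xs = length (deduplicate ℕ._≟_ xs)

occurrences-head : ∀ x xs → occurrences x (x ∷ xs) ≡ suc (occurrences x xs)
occurrences-head x xs with x ℕ.≟ x
... | yes _   = refl
... | no  x≢x = contradiction refl x≢x

occurrences-other : ∀ {b x} xs → x ≢ b → occurrences b (x ∷ xs) ≡ occurrences b xs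
occurrences-other {b} {x} xs x≢b with x ℕ.≟ b
... | yes x≡b = contradiction x≡b x≢b
... | no  _   = refl

occurrences-∷ : ∀ {b} x {xs ys} → occurrences b xs ≡ occurrences b ys → occurrences b (x ∷ xs) ≡ occurrences b (x ∷ ys)
occurrences-∷ {b} x eq with x ℕ.≟ b
... | yes _ = cong suc eq
... | no  _ = eq

occurrences-++ : ∀ b xs ys → occurrences b (xs ++ ys) ≡ occurrences b xs ℕ.+ occurrences b ys
occurrences-++ b []       ys = refl
occurrences-++ b (x ∷ xs) ys with x ℕ.≟ b
... | yes _ = cong suc (occurrences-++ b xs ys)
... | no  _ = occurrences-++ b xs ys

removeAll-head : ∀ a xs → removeAll a (a ∷ xs) ≡ removeAll a xs
removeAll-head a xs = ListP.filter-reject (λ y → ¬? (a ℕ.≟ y)) (λ a≢a → a≢a refl)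

removeAll-other : ∀ {a x} xs → a ≢ x → removeAll a (x ∷ xs) ≡ x ∷ removeAll a xs
removeAll-other {a} xs a≢x = ListP.filter-accept (λ y → ¬? (a ℕ.≟ y)) a≢x

removeAll-++ : ∀ a xs ys → removeAll a (xs ++ ys) ≡ removeAll a xs ++ removeAll a ys
removeAll-++ a = ListP.filter-++ (λ y → ¬? (a ℕ.≟ y))

removeAll-idem : ∀ a xs → removeAll a (removeAll a xs) ≡ removeAll a xs
removeAll-idem a = ListP.filter-idem (λ y → ¬? (a ℕ.≟ y))

removeAll-comm : ∀ a b xs → removeAll a (removeAll b xs) ≡ removeAll b (removeAll a xs)
removeAll-comm a b [] = refl
removeAll-comm a b (x ∷ xs) with a ℕ.≟ x | b ℕ.≟ x
... | yes refl | yes refl = refl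
... | yes refl | no  b≢a = begin
  removeAll a (removeAll b (a ∷ xs)) ≡⟨ cong (removeAll a) (removeAll-other xs b≢a) ⟩
  removeAll a (a ∷ removeAll b xs)   ≡⟨ removeAll-head a (removeAll b xs) ⟩
  removeAll a (removeAll b xs)       ≡⟨ removeAll-comm a b xs ⟩
  removeAll b (removeAll a xs)       ≡⟨ cong (removeAll b) (removeAll-head a xs) ⟨
  removeAll b (removeAll a (a ∷ xs)) ∎
  where open ≡-Reasoning
... | no  a≢b | yes refl = begin
  removeAll a (removeAll b (b ∷ xs)) ≡⟨ cong (removeAll a) (removeAll-head b xs) ⟩
  removeAll a (removeAll b xs)       ≡⟨ removeAll-comm a b xs ⟩
  removeAll b (removeAll a xs)       ≡⟨ removeAll-head b (removeAll a xs) ⟨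
  removeAll b (b ∷ removeAll a xs)   ≡⟨ cong (removeAll b) (removeAll-other xs a≢b) ⟨
  removeAll b (removeAll a (b ∷ xs)) ∎
  where open ≡-Reasoning
... | no  a≢x | no  b≢x = begin
  removeAll a (removeAll b (x ∷ xs)) ≡⟨ cong (removeAll a) (removeAll-other xs b≢x) ⟩
  removeAll a (x ∷ removeAll b xs)   ≡⟨ removeAll-other (removeAll b xs) a≢x ⟩
  x ∷ removeAll a (removeAll b xs)   ≡⟨ cong (x ∷_) (removeAll-comm a b xs) ⟩
  x ∷ removeAll b (removeAll a xs)   ≡⟨ removeAll-other (removeAll a xs) b≢x ⟨
  removeAll b (x ∷ removeAll a xs)   ≡⟨ cong (removeAll b) (removeAll-other xs a≢x) ⟨
  removeAll b (removeAll a (x ∷ xs)) ∎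
  where open ≡-Reasoning

removeAll-deduplicate : ∀ a xs → removeAll a (deduplicate ℕ._≟_ xs) ≡ deduplicate ℕ._≟_ (removeAll a xs)
removeAll-deduplicate a [] = refl
removeAll-deduplicate a (x ∷ xs) with a ℕ.≟ x
... | yes refl = begin
  removeAll a (a ∷ removeAll a (dedup xs)) ≡⟨ removeAll-head a _ ⟩
  removeAll a (removeAll a (dedup xs))     ≡⟨ removeAll-idem a (dedup xs) ⟩
  removeAll a (dedup xs)                   ≡⟨ removeAll-deduplicate a xs ⟩
  dedup (removeAll a xs)                   ≡⟨ cong dedup (removeAll-head a xs) ⟨
  dedup (removeAll a (a ∷ xs))             ∎
  where
  open ≡-Reasoning
  dedup = deduplicate ℕ._≟_
... | no a≢x = begin
  removeAll a (x ∷ removeAll x (dedup xs)) ≡⟨ removeAll-other _ a≢x ⟩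
  x ∷ removeAll a (removeAll x (dedup xs)) ≡⟨ cong (x ∷_) (removeAll-comm a x (dedup xs)) ⟩
  x ∷ removeAll x (removeAll a (dedup xs)) ≡⟨ cong (λ ys → x ∷ removeAll x ys) (removeAll-deduplicate a xs) ⟩
  dedup (x ∷ removeAll a xs)               ≡⟨ cong dedup (removeAll-other xs a≢x) ⟨
  dedup (removeAll a (x ∷ xs))             ∎
  where
  open ≡-Reasoning
  dedup = deduplicate ℕ._≟_

occurrences-removeAll-self : ∀ a xs → occurrences a (removeAll a xs) ≡ 0
occurrences-removeAll-self a [] = refl
occurrences-removeAll-self a (x ∷ xs) with a ℕ.≟ x
... | yes refl = trans (cong (occurrences a) (removeAll-head a xs)) (occurrences-removeAll-self a xs)
... | no  a≢x  = begin
  occurrences a (removeAll a (x ∷ xs)) ≡⟨ cong (occurrences a) (removeAll-other xs a≢x) ⟩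
  occurrences a (x ∷ removeAll a xs)   ≡⟨ occurrences-other (removeAll a xs) (λ x≡a → a≢x (sym x≡a)) ⟩
  occurrences a (removeAll a xs)       ≡⟨ occurrences-removeAll-self a xs ⟩
  0                                    ∎
  where open ≡-Reasoning

occurrences-removeAll-other : ∀ a b xs → a ≢ b → occurrences b (removeAll a xs) ≡ occurrences b xs
occurrences-removeAll-other a b [] a≢b = refl
occurrences-removeAll-other a b (x ∷ xs) a≢b with a ℕ.≟ x
... | yes refl = begin
  occurrences b (removeAll a (a ∷ xs)) ≡⟨ cong (occurrences b) (removeAll-head a xs) ⟩
  occurrences b (removeAll a xs)       ≡⟨ occurrences-removeAll-other a b xs a≢b ⟩
  occurrences b xs                     ≡⟨ occurrences-other xs a≢b ⟨
  occurrences b (a ∷ xs)               ∎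
  where open ≡-Reasoning
... | no  a≢x  = trans (cong (occurrences b) (removeAll-other xs a≢x))
                       (occurrences-∷ x (occurrences-removeAll-other a b xs a≢b))

length≡occurrences+length-removeAll : ∀ b xs → length xs ≡ occurrences b xs ℕ.+ length (removeAll b xs)
length≡occurrences+length-removeAll b [] = refl
length≡occurrences+length-removeAll b (x ∷ xs) with b ℕ.≟ x
... | yes refl = begin
  suc (length xs)                                   ≡⟨ cong suc (length≡occurrences+length-removeAll b xs) ⟩
  suc (occurrences b xs ℕ.+ length (removeAll b xs)) ≡⟨ cong₂ ℕ._+_ (occurrences-head b xs) (cong length (removeAll-head b xs)) ⟨
  occurrences b (b ∷ xs) ℕ.+ length (removeAll b (b ∷ xs)) ∎
  where open ≡-Reasoning
... | no b≢x with x ℕ.≟ b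
...   | yes x≡b = contradiction (sym x≡b) b≢x
...   | no  _   = begin
  suc (length xs)                                      ≡⟨ cong suc (length≡occurrences+length-removeAll b xs) ⟩
  suc (occurrences b xs ℕ.+ length (removeAll b xs))   ≡⟨ ℕP.+-suc _ _ ⟨
  occurrences b xs ℕ.+ suc (length (removeAll b xs))   ≡⟨ cong (λ ys → occurrences b xs ℕ.+ length ys) (removeAll-other xs b≢x) ⟨
  occurrences b xs ℕ.+ length (removeAll b (x ∷ xs))   ∎
  where open ≡-Reasoning

occurrences-deduplicate : ∀ b xs → occurrences b (deduplicate ℕ._≟_ xs) ≡ occupied (occurrences b xs)
occurrences-deduplicate b [] = refl
occurrences-deduplicate b (x ∷ xs) with x ℕ.≟ b
... | yes refl = cong suc (occurrences-removeAll-self x (deduplicate ℕ._≟_ xs))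
... | no  x≢b  = trans (occurrences-removeAll-other x b (deduplicate ℕ._≟_ xs) x≢b) (occurrences-deduplicate b xs)

distinct≡occupied+distinct-removeAll : ∀ b xs → distinct xs ≡ occupied (occurrences b xs) ℕ.+ distinct (removeAll b xs)
distinct≡occupied+distinct-removeAll b xs = begin
  length (dedup xs)                                                 ≡⟨ length≡occurrences+length-removeAll b (dedup xs) ⟩
  occurrences b (dedup xs) ℕ.+ length (removeAll b (dedup xs))      ≡⟨ cong₂ ℕ._+_ (occurrences-deduplicate b xs)
                                                                         (cong length (removeAll-deduplicate b xs)) ⟩
  occupied (occurrences b xs) ℕ.+ distinct (removeAll b xs)         ∎
  where
  open ≡-Reasoning
  dedup = deduplicate ℕ._≟_

distinct-∷ʳ : ∀ xs y → distinct xs ℕ.≤ distinct (xs List.∷ʳ y)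
distinct-∷ʳ xs y = begin
  distinct xs                                                  ≡⟨ distinct≡occupied+distinct-removeAll y xs ⟩
  occupied (occurrences y xs) ℕ.+ distinct (removeAll y xs)    ≤⟨ ℕP.+-monoˡ-≤ _ (occupied≤1 (occurrences y xs)) ⟩
  1 ℕ.+ distinct (removeAll y xs)                              ≡⟨ cong₂ ℕ._+_ occupied-snoc (cong distinct removeAll-snoc) ⟨
  occupied (occurrences y (xs List.∷ʳ y)) ℕ.+ distinct (removeAll y (xs List.∷ʳ y)) ≡⟨ distinct≡occupied+distinct-removeAll y (xs List.∷ʳ y) ⟨
  distinct (xs List.∷ʳ y)                                      ∎
  where
  open ℕP.≤-Reasoning
  occupied≤1 : ∀ c → occupied c ℕ.≤ 1
  occupied≤1 zero    = z≤n
  occupied≤1 (suc _) = s≤s z≤n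
  occupied-snoc : occupied (occurrences y (xs List.∷ʳ y)) ≡ 1
  occupied-snoc = cong occupied (trans (occurrences-++ y xs [ y ])
    (trans (cong (occurrences y xs ℕ.+_) (occurrences-head y [])) (ℕP.+-suc _ 0)))
  removeAll-snoc : removeAll y (xs List.∷ʳ y) ≡ removeAll y xs
  removeAll-snoc = trans (removeAll-++ y xs [ y ])
    (trans (cong (removeAll y xs ++_) (removeAll-head y [])) (ListP.++-identityʳ _))

distinct-++ : ∀ xs ys → distinct xs ℕ.≤ distinct (xs ++ ys)
distinct-++ xs []       = ℕP.≤-reflexive (cong distinct (sym (ListP.++-identityʳ xs)))
distinct-++ xs (y ∷ ys) = ℕP.≤-trans (distinct-∷ʳ xs y)
  (subst (λ zs → distinct (xs List.∷ʳ y) ℕ.≤ distinct zs) (ListP.++-assoc xs [ y ] ys) (distinct-++ (xs List.∷ʳ y) ys))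

distinct-take : ∀ k xs → distinct (take k xs) ℕ.≤ distinct xs
distinct-take k xs = subst (λ ys → distinct (take k xs) ℕ.≤ distinct ys) (ListP.take++drop≡id k xs)
  (distinct-++ (take k xs) (drop k xs))

size : List ℕ → List ℕ → List ℕ → ℕ
size R₁ R₂ R₃ = length R₁ ℕ.+ (length R₂ ℕ.+ length R₃)

binsOpen : List ℕ → List ℕ → List ℕ → ℕ
binsOpen R₁ R₂ R₃ = distinct R₁ ℕ.+ (distinct (R₁ ++ R₂) ℕ.+ distinct (R₁ ++ (R₂ ++ R₃)))

EveryBinWeightBounded : List ℕ → List ℕ → List ℕ → Set
EveryBinWeightBounded R₁ R₂ R₃ = ∀ b → WeightBounded (occurrences b R₁) (occurrences b R₂) (occurrences b R₃)

module _ where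
  open +-*-Solver

  +-interchange₃ : ∀ a₁ a₂ a₃ b₁ b₂ b₃ →
    (a₁ ℕ.+ b₁) ℕ.+ ((a₂ ℕ.+ b₂) ℕ.+ (a₃ ℕ.+ b₃)) ≡ (a₁ ℕ.+ (a₂ ℕ.+ a₃)) ℕ.+ (b₁ ℕ.+ (b₂ ℕ.+ b₃))
  +-interchange₃ = solve 6 (λ a₁ a₂ a₃ b₁ b₂ b₃ → (a₁ :+ b₁) :+ ((a₂ :+ b₂) :+ (a₃ :+ b₃))
                                               := (a₁ :+ (a₂ :+ a₃)) :+ (b₁ :+ (b₂ :+ b₃))) refl

  weight-+ : ∀ a₁ a₂ a₃ b₁ b₂ b₃ →
    weight (a₁ ℕ.+ b₁) (a₂ ℕ.+ b₂) (a₃ ℕ.+ b₃) ≡ weight a₁ a₂ a₃ ℕ.+ weight b₁ b₂ b₃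
  weight-+ = solve 6 (λ a₁ a₂ a₃ b₁ b₂ b₃ → (a₁ :+ b₁) :+ (con 2 :* (a₂ :+ b₂) :+ con 2 :* (a₃ :+ b₃))
             := (a₁ :+ (con 2 :* a₂ :+ con 2 :* a₃)) :+ (b₁ :+ (con 2 :* b₂ :+ con 2 :* b₃))) refl

size-removeAll : ∀ b R₁ R₂ R₃ → size R₁ R₂ R₃ ≡
  (occurrences b R₁ ℕ.+ (occurrences b R₂ ℕ.+ occurrences b R₃)) ℕ.+ size (removeAll b R₁) (removeAll b R₂) (removeAll b R₃)
size-removeAll b R₁ R₂ R₃
  rewrite length≡occurrences+length-removeAll b R₁
        | length≡occurrences+length-removeAll b R₂
        | length≡occurrences+length-removeAll b R₃
  = +-interchange₃ (occurrences b R₁) (occurrences b R₂) (occurrences b R₃)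
                   (length (removeAll b R₁)) (length (removeAll b R₂)) (length (removeAll b R₃))

weight-removeAll : ∀ b R₁ R₂ R₃ → weight (length R₁) (length R₂) (length R₃) ≡
  weight (occurrences b R₁) (occurrences b R₂) (occurrences b R₃) ℕ.+
  weight (length (removeAll b R₁)) (length (removeAll b R₂)) (length (removeAll b R₃))
weight-removeAll b R₁ R₂ R₃
  rewrite length≡occurrences+length-removeAll b R₁
        | length≡occurrences+length-removeAll b R₂
        | length≡occurrences+length-removeAll b R₃
  = weight-+ (occurrences b R₁) (occurrences b R₂) (occurrences b R₃)
             (length (removeAll b R₁)) (length (removeAll b R₂)) (length (removeAll b R₃))

binsOpen-removeAll : ∀ b R₁ R₂ R₃ → binsOpen R₁ R₂ R₃ ≡
  phasesOpen (occurrences b R₁) (occurrences b R₂) (occurrences b R₃) ℕ.+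
  binsOpen (removeAll b R₁) (removeAll b R₂) (removeAll b R₃)
binsOpen-removeAll b R₁ R₂ R₃
  rewrite distinct≡occupied+distinct-removeAll b R₁
        | distinct≡occupied+distinct-removeAll b (R₁ ++ R₂)
        | distinct≡occupied+distinct-removeAll b (R₁ ++ (R₂ ++ R₃))
        | occurrences-++ b R₁ R₂ | occurrences-++ b R₁ (R₂ ++ R₃) | occurrences-++ b R₂ R₃
        | removeAll-++ b R₁ R₂ | removeAll-++ b R₁ (R₂ ++ R₃) | removeAll-++ b R₂ R₃
  = +-interchange₃ (occupied c₁) (occupied (c₁ ℕ.+ c₂)) (occupied (c₁ ℕ.+ (c₂ ℕ.+ c₃)))
                   (distinct S₁) (distinct (S₁ ++ S₂)) (distinct (S₁ ++ (S₂ ++ S₃)))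
  where
  c₁ = occurrences b R₁
  c₂ = occurrences b R₂
  c₃ = occurrences b R₃
  S₁ = removeAll b R₁
  S₂ = removeAll b R₂
  S₃ = removeAll b R₃

everyBinWeightBounded-removeAll : ∀ b {R₁ R₂ R₃} → EveryBinWeightBounded R₁ R₂ R₃ →
  EveryBinWeightBounded (removeAll b R₁) (removeAll b R₂) (removeAll b R₃)
everyBinWeightBounded-removeAll b {R₁} {R₂} {R₃} bounded b′ with b ℕ.≟ b′
... | yes refl
  rewrite occurrences-removeAll-self b R₁ | occurrences-removeAll-self b R₂ | occurrences-removeAll-self b R₃
  = z≤n
... | no b≢b′
  rewrite occurrences-removeAll-other b b′ R₁ b≢b′ | occurrences-removeAll-other b b′ R₂ b≢b′
        | occurrences-removeAll-other b b′ R₃ b≢b′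
  = bounded b′

weight≤2*binsOpen-step : ∀ b {n} R₁ R₂ R₃ → EveryBinWeightBounded R₁ R₂ R₃ →
  1 ℕ.≤ occurrences b R₁ ℕ.+ (occurrences b R₂ ℕ.+ occurrences b R₃) → size R₁ R₂ R₃ ℕ.≤ suc n →
  (∀ S₁ S₂ S₃ → EveryBinWeightBounded S₁ S₂ S₃ → size S₁ S₂ S₃ ℕ.≤ n →
     weight (length S₁) (length S₂) (length S₃) ℕ.≤ 2 ℕ.* binsOpen S₁ S₂ S₃) →
  weight (length R₁) (length R₂) (length R₃) ℕ.≤ 2 ℕ.* binsOpen R₁ R₂ R₃
weight≤2*binsOpen-step b {n} R₁ R₂ R₃ bounded 1≤occurrences size≤1+n ih =
  subst₂ ℕ._≤_ (sym (weight-removeAll b R₁ R₂ R₃))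
    (sym (trans (cong (2 ℕ.*_) (binsOpen-removeAll b R₁ R₂ R₃))
                (ℕP.*-distribˡ-+ 2 (phasesOpen (occurrences b R₁) (occurrences b R₂) (occurrences b R₃))
                                   (binsOpen S₁ S₂ S₃))))
    (ℕP.+-mono-≤ (bounded b) (ih S₁ S₂ S₃ (everyBinWeightBounded-removeAll b {R₁} {R₂} {R₃} bounded) size≤n))
  where
  S₁ = removeAll b R₁
  S₂ = removeAll b R₂
  S₃ = removeAll b R₃
  size≤n : size S₁ S₂ S₃ ℕ.≤ n
  size≤n = ℕP.≤-pred (ℕP.≤-trans (ℕP.+-monoˡ-≤ (size S₁ S₂ S₃) 1≤occurrences)
             (ℕP.≤-trans (ℕP.≤-reflexive (sym (size-removeAll b R₁ R₂ R₃))) size≤1+n))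

weight≤2*binsOpen : ∀ R₁ R₂ R₃ → EveryBinWeightBounded R₁ R₂ R₃ →
  weight (length R₁) (length R₂) (length R₃) ℕ.≤ 2 ℕ.* binsOpen R₁ R₂ R₃
weight≤2*binsOpen R₁ R₂ R₃ bounded = go (size R₁ R₂ R₃) R₁ R₂ R₃ bounded ℕP.≤-refl
  where
  first : ∀ x xs → 1 ℕ.≤ occurrences x (x ∷ xs)
  first x xs = subst (1 ℕ.≤_) (sym (occurrences-head x xs)) (s≤s z≤n)
  go : ∀ n S₁ S₂ S₃ → EveryBinWeightBounded S₁ S₂ S₃ → size S₁ S₂ S₃ ℕ.≤ n →
       weight (length S₁) (length S₂) (length S₃) ℕ.≤ 2 ℕ.* binsOpen S₁ S₂ S₃
  go n       []       []       []       _ _  = z≤n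
  go zero    (_ ∷ _)  _        _        _ ()
  go zero    []       (_ ∷ _)  _        _ ()
  go zero    []       []       (_ ∷ _)  _ ()
  go (suc n) S₁@(x ∷ xs) S₂ S₃ bounded size≤ =
    weight≤2*binsOpen-step x S₁ S₂ S₃ bounded (ℕP.≤-trans (first x xs) (ℕP.m≤m+n _ _)) size≤ (go n)
  go (suc n) [] S₂@(x ∷ xs) S₃ bounded size≤ =
    weight≤2*binsOpen-step x [] S₂ S₃ bounded (ℕP.≤-trans (first x xs) (ℕP.m≤m+n _ _)) size≤ (go n)
  go (suc n) [] [] S₃@(x ∷ xs) bounded size≤ =
    weight≤2*binsOpen-step x [] [] S₃ bounded (first x xs) size≤ (go n)

load-replicate-++ : ∀ x R ss bs b →
  load (zip (replicate (length R) x ++ ss) (R ++ bs)) b ≡ copies (occurrences b R) x ℚ.+ load (zip ss bs) b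
load-replicate-++ x []      ss bs b = sym (ℚP.+-identityˡ _)
load-replicate-++ x (r ∷ R) ss bs b with r ℕ.≟ b
... | yes _ = trans (cong (x ℚ.+_) (load-replicate-++ x R ss bs b)) (sym (ℚP.+-assoc x _ _))
... | no  _ = load-replicate-++ x R ss bs b

load-replicate : ∀ x R b → load (zip (replicate (length R) x) R) b ≡ copies (occurrences b R) x
load-replicate x R b = begin
  load (zip (replicate (length R) x) R) b                  ≡⟨ cong₂ (λ ss bs → load (zip ss bs) b)
                                                                (ListP.++-identityʳ (replicate (length R) x)) (ListP.++-identityʳ R) ⟨
  load (zip (replicate (length R) x ++ []) (R ++ [])) b     ≡⟨ load-replicate-++ x R [] [] b ⟩
  copies (occurrences b R) x ℚ.+ ℚ.0ℚ                      ≡⟨ ℚP.+-identityʳ _ ⟩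
  copies (occurrences b R) x                               ∎
  where open ≡-Reasoning

load-phases : ∀ x₁ x₂ x₃ R₁ R₂ R₃ b →
  load (zip (replicate (length R₁) x₁ ++ (replicate (length R₂) x₂ ++ replicate (length R₃) x₃)) (R₁ ++ (R₂ ++ R₃))) b
  ≡ copies (occurrences b R₁) x₁ ℚ.+ (copies (occurrences b R₂) x₂ ℚ.+ copies (occurrences b R₃) x₃)
load-phases x₁ x₂ x₃ R₁ R₂ R₃ b =
  trans (load-replicate-++ x₁ R₁ _ _ b)
    (cong (copies (occurrences b R₁) x₁ ℚ.+_)
      (trans (load-replicate-++ x₂ R₂ _ _ b) (cong (copies (occurrences b R₂) x₂ ℚ.+_) (load-replicate x₃ R₃ b))))

blocks : ℕ → ℕ → ℕ → List ℕ
blocks g k zero    = []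
blocks g k (suc q) = replicate g k ++ blocks g (suc k) q

occurrences-replicate-self : ∀ g k → occurrences k (replicate g k) ≡ g
occurrences-replicate-self zero    k = refl
occurrences-replicate-self (suc g) k = trans (occurrences-head k (replicate g k)) (cong suc (occurrences-replicate-self g k))

occurrences-replicate-other : ∀ g {k b} → k ≢ b → occurrences b (replicate g k) ≡ 0
occurrences-replicate-other zero    k≢b = refl
occurrences-replicate-other (suc g) {k} {b} k≢b with k ℕ.≟ b
... | yes k≡b = contradiction k≡b k≢b
... | no  _   = occurrences-replicate-other g k≢b

occurrences-blocks-< : ∀ g k q {b} → b ℕ.< k → occurrences b (blocks g k q) ≡ 0
occurrences-blocks-< g k zero    b<k = refl
occurrences-blocks-< g k (suc q) {b} b<k = trans (occurrences-++ b (replicate g k) _)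
  (cong₂ ℕ._+_ (occurrences-replicate-other g (λ k≡b → ℕP.<⇒≢ b<k (sym k≡b)))
               (occurrences-blocks-< g (suc k) q (ℕP.m<n⇒m<1+n b<k)))

occurrences-blocks-≤ : ∀ g k q b → occurrences b (blocks g k q) ℕ.≤ g
occurrences-blocks-≤ g k zero    b = z≤n
occurrences-blocks-≤ g k (suc q) b with k ℕ.≟ b
... | yes refl = ℕP.≤-reflexive (begin
  occurrences k (replicate g k ++ blocks g (suc k) q)               ≡⟨ occurrences-++ k (replicate g k) _ ⟩
  occurrences k (replicate g k) ℕ.+ occurrences k (blocks g (suc k) q) ≡⟨ cong₂ ℕ._+_ (occurrences-replicate-self g k)
                                                                           (occurrences-blocks-< g (suc k) q (ℕP.n<1+n k)) ⟩
  g ℕ.+ 0                                                           ≡⟨ ℕP.+-identityʳ g ⟩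
  g                                                                 ∎)
  where open ≡-Reasoning
... | no k≢b = subst (ℕ._≤ g)
  (sym (trans (occurrences-++ b (replicate g k) (blocks g (suc k) q))
    (cong (ℕ._+ occurrences b (blocks g (suc k) q)) (occurrences-replicate-other g k≢b))))
  (occurrences-blocks-≤ g (suc k) q b)

length-blocks : ∀ g k q → length (blocks g k q) ≡ q ℕ.* g
length-blocks g k zero    = refl
length-blocks g k (suc q) =
  trans (ListP.length-++ (replicate g k)) (cong₂ ℕ._+_ (ListP.length-replicate g) (length-blocks g (suc k) q))

blocks-< : ∀ g k q → All (ℕ._< k ℕ.+ q) (blocks g k q)
blocks-< g k zero    = []
blocks-< g k (suc q) = AllP.++⁺ (AllP.replicate⁺ g (ℕP.m<m+n k (s≤s z≤n)))
  (subst (λ m → All (ℕ._< m) (blocks g (suc k) q)) (sym (ℕP.+-suc k q)) (blocks-< g (suc k) q))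

phases-packable : ∀ g q {x₁ x₂ x₃} → ℚ.0ℚ ≤ x₁ → ℚ.0ℚ ≤ x₂ → ℚ.0ℚ ≤ x₃ →
  copies g x₁ ℚ.+ (copies g x₂ ℚ.+ copies g x₃) ≤ 1ℚ →
  PackableIn (replicate (q ℕ.* g) x₁ ++ (replicate (q ℕ.* g) x₂ ++ replicate (q ℕ.* g) x₃)) q
phases-packable g q {x₁} {x₂} {x₃} 0≤x₁ 0≤x₂ 0≤x₃ fits =
  subst (λ m → PackableIn (replicate m x₁ ++ (replicate m x₂ ++ replicate m x₃)) q) (length-blocks g 0 q)
    (B ++ (B ++ B) , length-assignment , AllP.++⁺ (blocks-< g 0 q) (AllP.++⁺ (blocks-< g 0 q) (blocks-< g 0 q)) , feasible)
  where
  B = blocks g 0 q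
  sizes₀ = replicate (length B) x₁ ++ (replicate (length B) x₂ ++ replicate (length B) x₃)
  length-phases : ∀ {A : Set} (xs ys zs : List A) → length (xs ++ (ys ++ zs)) ≡ length xs ℕ.+ (length ys ℕ.+ length zs)
  length-phases xs ys zs = trans (ListP.length-++ xs) (cong (length xs ℕ.+_) (ListP.length-++ ys))
  length-assignment : length (B ++ (B ++ B)) ≡ length sizes₀
  length-assignment = trans (length-phases B B B) (sym (trans
    (length-phases (replicate (length B) x₁) (replicate (length B) x₂) (replicate (length B) x₃))
    (cong₂ ℕ._+_ (ListP.length-replicate (length B))
      (cong₂ ℕ._+_ (ListP.length-replicate (length B)) (ListP.length-replicate (length B))))))
  feasible : Feasible (zip sizes₀ (B ++ (B ++ B)))
  feasible b = subst (_≤ 1ℚ) (sym (load-phases x₁ x₂ x₃ B B B b))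
    (ℚP.≤-trans (ℚP.+-mono-≤ (copies-monoˡ-≤ 0≤x₁ (occurrences-blocks-≤ g 0 q b))
                  (ℚP.+-mono-≤ (copies-monoˡ-≤ 0≤x₂ (occurrences-blocks-≤ g 0 q b))
                               (copies-monoˡ-≤ 0≤x₃ (occurrences-blocks-≤ g 0 q b)))) fits)

runFrom-take : ∀ A δ n e (hist : List (Fin n × ℚ)) k xs ys → take k xs ≡ take k ys →
               take k (runFrom A δ n e hist xs) ≡ take k (runFrom A δ n e hist ys)
runFrom-take A δ n e hist zero    xs       ys       _  = refl
runFrom-take A δ n e hist (suc k) []       []       _  = refl
runFrom-take A δ n e hist (suc k) (x ∷ xs) (y ∷ ys) eq with ListP.∷-injective eq
... | refl , xs≈ys = cong (A δ n e (hist ++ [ x ]) ∷_) (runFrom-take A δ n e (hist ++ [ x ]) k xs ys xs≈ys)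

length-runFrom : ∀ A δ n e (hist : List (Fin n × ℚ)) xs → length (runFrom A δ n e hist xs) ≡ length xs
length-runFrom A δ n e hist []       = refl
length-runFrom A δ n e hist (x ∷ xs) = cong suc (length-runFrom A δ n e (hist ++ [ x ]) xs)

take-tabulate : ∀ {B : Set} {m} k {f g : Fin m → B} → (∀ {i} → toℕ i ℕ.< k → f i ≡ g i) →
                take k (List.tabulate f) ≡ take k (List.tabulate g)
take-tabulate         zero    f≈g = refl
take-tabulate {m = zero}  (suc k) f≈g = refl
take-tabulate {m = suc m} (suc k) f≈g = cong₂ _∷_ (f≈g {Fin.zero} (s≤s z≤n)) (take-tabulate k (λ i<k → f≈g (s≤s i<k)))

take-+ : ∀ {B : Set} k l (xs : List B) → take (k ℕ.+ l) xs ≡ take k xs ++ take l (drop k xs)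
take-+ zero    l xs       = refl
take-+ (suc k) l []       = sym (ListP.take-[] l)
take-+ (suc k) l (x ∷ xs) = cong (x ∷_) (take-+ k l xs)

length-take-+ : ∀ {B : Set} k {l} (xs : List B) → length xs ≡ k ℕ.+ l → length (take k xs) ≡ k
length-take-+ zero    xs       _  = refl
length-take-+ (suc k) (x ∷ xs) eq = cong suc (length-take-+ k xs (ℕP.suc-injective eq))

length-drop-+ : ∀ {B : Set} k {l} (xs : List B) → length xs ≡ k ℕ.+ l → length (drop k xs) ≡ l
length-drop-+ zero    xs       eq = eq
length-drop-+ (suc k) (x ∷ xs) eq = length-drop-+ k xs (ℕP.suc-injective eq)

¬¬-least : ∀ {P : ℕ → Set} {q} → P q → ¬ ¬ (Σ ℕ λ m → P m × (∀ m′ → P m′ → m ℕ.≤ m′))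
¬¬-least {P} {q} Pq ¬least = none-below (suc q) q ℕP.≤-refl Pq
  where
  none-below : ∀ k j → j ℕ.< k → ¬ P j
  none-below (suc k) j (s≤s j≤k) Pj with ℕP.m≤n⇒m<n∨m≡n j≤k
  ... | inj₁ j<k  = none-below k j j<k Pj
  ... | inj₂ refl = ¬least (j , Pj , λ m′ Pm′ → ℕP.≮⇒≥ (λ m′<j → none-below j m′ m′<j Pm′))

-- A negative ratio c would not be monotone in OPT, hence c ⊔ 0.
bins-≤-packing : ∀ {c K ss a} → (∀ m → IsOPT ss m → toℚ a ≤ c ℚ.* toℚ m ℚ.+ K) →
  ∀ {q} → PackableIn ss q → ¬ ¬ (toℚ a ≤ (c ℚ.⊔ ℚ.0ℚ) ℚ.* toℚ q ℚ.+ K)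
bins-≤-packing {c} {K} bound {q} packable goal = ¬¬-least packable λ (m , opt) →
  goal (ℚP.≤-trans (bound m opt) (ℚP.+-monoˡ-≤ K (ℚP.≤-trans
    (ℚP.*-monoʳ-≤-nonNeg (toℚ m) {{ℚ.nonNegative (toℚ-nonNeg m)}} (ℚP.p≤p⊔q c ℚ.0ℚ))
    (ℚP.*-monoˡ-≤-nonNeg (c ℚ.⊔ ℚ.0ℚ) {{ℚ.nonNegative (ℚP.p≤q⊔p c ℚ.0ℚ)}} (toℚ-mono-≤ (proj₂ opt q packable))))))

-- With δ > 41/43, an item of size s announced as 43s/84 is admissible, as is a tiny item of size at
-- most 2s/84 with the same estimate.
estimate : ℚ → ℚ
estimate s = s ℚ.* (+ 43 / 84)

module Accuracy (δ : ℚ) (41/43<δ : + 41 / 43 < δ) where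

  Within : ℚ → ℚ → Set
  Within e x = (e ℚ.* (1ℚ ℚ.- δ) ≤ x) × (x ≤ (e ℚ.* (1ℚ ℚ.+ δ)) ℚ.⊓ 1ℚ)

  lowest : ℚ → ℚ
  lowest e = e ℚ.* (1ℚ ℚ.- δ)

  1-δ≤2/43 : 1ℚ ℚ.- δ ≤ + 2 / 43
  1-δ≤2/43 = ℚP.≤-trans (ℚP.+-monoʳ-≤ 1ℚ (ℚP.neg-antimono-≤ (ℚP.<⇒≤ 41/43<δ))) (ℚP.≤ᵇ⇒≤ _)

  84/43≤1+δ : + 84 / 43 ≤ 1ℚ ℚ.+ δ
  84/43≤1+δ = ℚP.≤-trans (ℚP.≤ᵇ⇒≤ _) (ℚP.+-monoʳ-≤ 1ℚ (ℚP.<⇒≤ 41/43<δ))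

  lowest-≤ : ∀ e → ℚ.0ℚ ≤ e → lowest e ≤ e ℚ.* (+ 2 / 43)
  lowest-≤ e 0≤e = ℚP.*-monoˡ-≤-nonNeg e {{ℚ.nonNegative 0≤e}} 1-δ≤2/43

  within : ∀ e x → ℚ.0ℚ ≤ e → e ℚ.* (+ 2 / 43) ≤ x → x ≤ e ℚ.* (+ 84 / 43) → x ≤ 1ℚ → Within e x
  within e x 0≤e lower upper x≤1 =
      ℚP.≤-trans (lowest-≤ e 0≤e) lower
    , ℚP.⊓-glb (ℚP.≤-trans upper (ℚP.*-monoˡ-≤-nonNeg e {{ℚ.nonNegative 0≤e}} 84/43≤1+δ)) x≤1

  within-lowest : ∀ e → ℚ.0ℚ ≤ e → e ℚ.* (+ 2 / 43) ≤ 1ℚ → Within e (lowest e)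
  within-lowest e 0≤e small≤1 = ℚP.≤-refl ,
    ℚP.⊓-glb (ℚP.*-monoˡ-≤-nonNeg e {{ℚ.nonNegative 0≤e}}
               (ℚP.≤-trans 1-δ≤2/43 (ℚP.≤-trans (ℚP.≤ᵇ⇒≤ _) 84/43≤1+δ)))
             (ℚP.≤-trans (lowest-≤ e 0≤e) small≤1)

module ThreePhase (δ : ℚ) (41/43<δ : + 41 / 43 < δ) (δ≤1 : δ ≤ 1ℚ) (M : ℕ) where

  open Accuracy δ 41/43<δ

  N items : ℕ
  N = M ℕ.* 6
  items = N ℕ.+ (N ℕ.+ N)

  byPhase : ℕ → ℚ → ℚ → ℚ → ℚ
  byPhase k a b c with k ℕ.<? N | k ℕ.<? N ℕ.+ N
  ... | yes _ | _     = a
  ... | no  _ | yes _ = b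
  ... | no  _ | no  _ = c

  byPhase-first : ∀ {k} → k ℕ.< N → ∀ a b c → byPhase k a b c ≡ a
  byPhase-first {k} k<N a b c with k ℕ.<? N
  ... | yes _   = refl
  ... | no  k≮N = contradiction k<N k≮N

  byPhase-second : ∀ {k} → k ℕ.< N → ∀ a b c → byPhase (N ℕ.+ k) a b c ≡ b
  byPhase-second {k} k<N a b c with N ℕ.+ k ℕ.<? N | N ℕ.+ k ℕ.<? N ℕ.+ N
  ... | yes N+k<N | _        = contradiction N+k<N (ℕP.m+n≮m N k)
  ... | no  _     | yes _    = refl
  ... | no  _     | no  N+k≮ = contradiction (ℕP.+-monoʳ-< N k<N) N+k≮

  byPhase-third : ∀ k a b c → byPhase (N ℕ.+ (N ℕ.+ k)) a b c ≡ c
  byPhase-third k a b c with N ℕ.+ (N ℕ.+ k) ℕ.<? N | N ℕ.+ (N ℕ.+ k) ℕ.<? N ℕ.+ N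
  ... | yes <N  | _     = contradiction <N (ℕP.m+n≮m N (N ℕ.+ k))
  ... | no  _   | yes <2N = contradiction (subst (ℕ._< N ℕ.+ N) (sym (ℕP.+-assoc N N k)) <2N) (ℕP.m+n≮m (N ℕ.+ N) k)
  ... | no  _   | no  _ = refl

  byPhase-agree₁ : ∀ {k} → k ℕ.< N → ∀ a b c b′ c′ → byPhase k a b c ≡ byPhase k a b′ c′
  byPhase-agree₁ k<N a b c b′ c′ = trans (byPhase-first k<N a b c) (sym (byPhase-first k<N a b′ c′))

  byPhase-agree₂ : ∀ {k} → k ℕ.< N ℕ.+ N → ∀ a b c c′ → byPhase k a b c ≡ byPhase k a b c′
  byPhase-agree₂ {k} k<2N a b c c′ with k ℕ.<? N | k ℕ.<? N ℕ.+ N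
  ... | yes _ | _      = refl
  ... | no  _ | yes _  = refl
  ... | no  _ | no  k≮ = contradiction k<2N k≮

  byPhase-elim : ∀ (P : ℚ → Set) k {a b c} → P a → P b → P c → P (byPhase k a b c)
  byPhase-elim P k Pa Pb Pc with k ℕ.<? N | k ℕ.<? N ℕ.+ N
  ... | yes _ | _     = Pa
  ... | no  _ | yes _ = Pb
  ... | no  _ | no  _ = Pc

  byPhase-elim₂ : ∀ (P : ℚ → ℚ → Set) k {a b c a′ b′ c′} → P a a′ → P b b′ → P c c′ →
                  P (byPhase k a b c) (byPhase k a′ b′ c′)
  byPhase-elim₂ P k Paa′ Pbb′ Pcc′ with k ℕ.<? N | k ℕ.<? N ℕ.+ N
  ... | yes _ | _     = Paa′
  ... | no  _ | yes _ = Pbb′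
  ... | no  _ | no  _ = Pcc′

  estimates : Vec.Vec ℚ items
  estimates = Vec.tabulate λ i → byPhase (toℕ i) (estimate small) (estimate medium) (estimate large)

  arrivals : ℚ → ℚ → List (Fin items × ℚ)
  arrivals x₂ x₃ = List.tabulate λ i → i , byPhase (toℕ i) small x₂ x₃

  phases : ℚ → ℚ → Instance
  phases x₂ x₃ = inst items estimates (arrivals x₂ x₃)

  phaseSizes : ℚ → ℚ → List ℚ
  phaseSizes x₂ x₃ = replicate N small ++ (replicate N x₂ ++ replicate N x₃)

  sizes-phases : ∀ x₂ x₃ → sizes (phases x₂ x₃) ≡ phaseSizes x₂ x₃
  sizes-phases x₂ x₃ = begin
    List.map proj₂ (arrival (phases x₂ x₃))            ≡⟨ ListP.map-tabulate _ proj₂ ⟩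
    List.tabulate (λ i → byPhase (toℕ i) small x₂ x₃)  ≡⟨ tabulate-toℕ items _ ⟩
    applyUpTo (λ k → byPhase k small x₂ x₃) items      ≡⟨ applyUpTo-++ _ N (N ℕ.+ N) ⟩
    applyUpTo (λ k → byPhase k small x₂ x₃) N ++ applyUpTo (λ k → byPhase (N ℕ.+ k) small x₂ x₃) (N ℕ.+ N)
      ≡⟨ cong₂ _++_ (applyUpTo-const _ N (λ k<N → byPhase-first k<N small x₂ x₃))
           (trans (applyUpTo-++ _ N N) (cong₂ _++_ (applyUpTo-const _ N (λ k<N → byPhase-second k<N small x₂ x₃))
                                                   (applyUpTo-const _ N (λ {k} _ → byPhase-third k small x₂ x₃)))) ⟩
    phaseSizes x₂ x₃                                  ∎
    where
    open ≡-Reasoning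
    tabulate-toℕ : ∀ m (f : ℕ → ℚ) → List.tabulate {n = m} (λ i → f (toℕ i)) ≡ applyUpTo f m
    tabulate-toℕ zero    f = refl
    tabulate-toℕ (suc m) f = cong (f 0 ∷_) (tabulate-toℕ m (λ k → f (suc k)))
    applyUpTo-++ : ∀ (f : ℕ → ℚ) k l → applyUpTo f (k ℕ.+ l) ≡ applyUpTo f k ++ applyUpTo (λ j → f (k ℕ.+ j)) l
    applyUpTo-++ f zero    l = refl
    applyUpTo-++ f (suc k) l = cong (f 0 ∷_) (applyUpTo-++ (λ j → f (suc j)) k l)
    applyUpTo-const : ∀ (f : ℕ → ℚ) {x} l → (∀ {k} → k ℕ.< l → f k ≡ x) → applyUpTo f l ≡ replicate l x
    applyUpTo-const f zero    f≡x = refl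
    applyUpTo-const f (suc l) f≡x = cong₂ _∷_ (f≡x (s≤s z≤n)) (applyUpTo-const (λ k → f (suc k)) l (λ k<l → f≡x (s≤s k<l)))

  within-small : Within (estimate small) small
  within-small = within (estimate small) small (ℚP.≤ᵇ⇒≤ _) (ℚP.≤ᵇ⇒≤ _) (ℚP.≤ᵇ⇒≤ _) (ℚP.≤ᵇ⇒≤ _)

  within-medium : Within (estimate medium) medium
  within-medium = within (estimate medium) medium (ℚP.≤ᵇ⇒≤ _) (ℚP.≤ᵇ⇒≤ _) (ℚP.≤ᵇ⇒≤ _) (ℚP.≤ᵇ⇒≤ _)

  within-large : Within (estimate large) large
  within-large = within (estimate large) large (ℚP.≤ᵇ⇒≤ _) (ℚP.≤ᵇ⇒≤ _) (ℚP.≤ᵇ⇒≤ _) (ℚP.≤ᵇ⇒≤ _)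

  within-lowest-medium : Within (estimate medium) (lowest (estimate medium))
  within-lowest-medium = within-lowest (estimate medium) (ℚP.≤ᵇ⇒≤ _) (ℚP.≤ᵇ⇒≤ _)

  within-lowest-large : Within (estimate large) (lowest (estimate large))
  within-lowest-large = within-lowest (estimate large) (ℚP.≤ᵇ⇒≤ _) (ℚP.≤ᵇ⇒≤ _)

  phases-admissible : ∀ {x₂ x₃} → Within (estimate medium) x₂ → Within (estimate large) x₃ → Admissible δ (phases x₂ x₃)
  phases-admissible {x₂} {x₃} within₂ within₃ =
      VecAllP.toList⁺ (VecAllP.tabulate⁺ λ i → byPhase-elim (λ e → (ℚ.0ℚ < e) × (e ≤ 1ℚ)) (toℕ i)
        (ℚP.positive⁻¹ _ {{_}} , ℚP.≤ᵇ⇒≤ _) (ℚP.positive⁻¹ _ {{_}} , ℚP.≤ᵇ⇒≤ _) (ℚP.positive⁻¹ _ {{_}} , ℚP.≤ᵇ⇒≤ _))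
    , ↭-reflexive (ListP.map-tabulate _ proj₁)
    , AllP.tabulate⁺ λ i → subst (λ e → Within e (byPhase (toℕ i) small x₂ x₃)) (sym (VecP.lookup∘tabulate _ i))
        (byPhase-elim₂ Within (toℕ i) {estimate small} {estimate medium} {estimate large} {small} {x₂} {x₃}
          within-small within₂ within₃)

  I₁ I₂ I₃ : Instance
  I₁ = phases (lowest (estimate medium)) (lowest (estimate large))
  I₂ = phases medium (lowest (estimate large))
  I₃ = phases medium large

  admissible₁ : Admissible δ I₁
  admissible₁ = phases-admissible within-lowest-medium within-lowest-large

  admissible₂ : Admissible δ I₂
  admissible₂ = phases-admissible within-medium within-lowest-large

  admissible₃ : Admissible δ I₃
  admissible₃ = phases-admissible within-medium within-large

  0≤lowest : ∀ e → ℚ.0ℚ ≤ e → ℚ.0ℚ ≤ lowest e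
  0≤lowest e 0≤e = ℚP.≤-trans (ℚP.≤-reflexive (sym (ℚP.*-zeroʳ e)))
    (ℚP.*-monoˡ-≤-nonNeg e {{ℚ.nonNegative 0≤e}}
      (subst (_≤ 1ℚ ℚ.- δ) (ℚP.+-inverseʳ 1ℚ) (ℚP.+-monoʳ-≤ 1ℚ (ℚP.neg-antimono-≤ δ≤1))))

  packable₁ : PackableIn (sizes I₁) M
  packable₁ = subst (λ ss → PackableIn ss M) (sym (sizes-phases (lowest (estimate medium)) (lowest (estimate large))))
    (phases-packable 6 M (ℚP.≤ᵇ⇒≤ _) (0≤lowest (estimate medium) (ℚP.≤ᵇ⇒≤ _)) (0≤lowest (estimate large) (ℚP.≤ᵇ⇒≤ _))
      (ℚP.≤-trans (ℚP.+-monoʳ-≤ (copies 6 small)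
        (ℚP.+-mono-≤ (copies-monoʳ-≤ (lowest-≤ (estimate medium) (ℚP.≤ᵇ⇒≤ _)) 6)
                     (copies-monoʳ-≤ (lowest-≤ (estimate large) (ℚP.≤ᵇ⇒≤ _)) 6)))
        (ℚP.≤ᵇ⇒≤ _)))

  packable₂ : PackableIn (sizes I₂) (M ℕ.* 3)
  packable₂ = subst (λ ss → PackableIn ss (M ℕ.* 3)) (sym (trans (sizes-phases medium (lowest (estimate large)))
                (cong (λ m → replicate m small ++ (replicate m medium ++ replicate m (lowest (estimate large))))
                  (sym (ℕP.*-assoc M 3 2)))))
    (phases-packable 2 (M ℕ.* 3) (ℚP.≤ᵇ⇒≤ _) (ℚP.≤ᵇ⇒≤ _) (0≤lowest (estimate large) (ℚP.≤ᵇ⇒≤ _))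
      (ℚP.≤-trans (ℚP.+-monoʳ-≤ (copies 2 small) (ℚP.+-monoʳ-≤ (copies 2 medium)
        (copies-monoʳ-≤ (lowest-≤ (estimate large) (ℚP.≤ᵇ⇒≤ _)) 2))) (ℚP.≤ᵇ⇒≤ _)))

  packable₃ : PackableIn (sizes I₃) N
  packable₃ = subst (λ ss → PackableIn ss N) (sym (trans (sizes-phases medium large)
                (cong (λ m → replicate m small ++ (replicate m medium ++ replicate m large)) (sym (ℕP.*-identityʳ N)))))
    (phases-packable 1 N (ℚP.≤ᵇ⇒≤ _) (ℚP.≤ᵇ⇒≤ _) (ℚP.≤ᵇ⇒≤ _) (ℚP.≤ᵇ⇒≤ _))

  phases-fit : ∀ R₁ R₂ R₃ → length R₁ ≡ N → length R₂ ≡ N → length R₃ ≡ N → Feasible (zip (sizes I₃) (R₁ ++ (R₂ ++ R₃))) →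
    ∀ b → binSize (occurrences b R₁) (occurrences b R₂) (occurrences b R₃) ≤ 1ℚ
  phases-fit R₁ R₂ R₃ length₁ length₂ length₃ feasible b = subst (_≤ 1ℚ) (load-phases small medium large R₁ R₂ R₃ b)
    (subst (λ ss → load (zip ss (R₁ ++ (R₂ ++ R₃))) b ≤ 1ℚ) sizes₃ (feasible b))
    where
    sizes₃ : sizes I₃ ≡ replicate (length R₁) small ++ (replicate (length R₂) medium ++ replicate (length R₃) large)
    sizes₃ = trans (sizes-phases medium large)
      (cong₂ _++_ (cong (λ l → replicate l small) (sym length₁))
        (cong₂ (λ l₂ l₃ → replicate l₂ medium ++ replicate l₃ large) (sym length₂) (sym length₃)))

  module _ (A : OnlineAlg) where

    length-run : ∀ x₂ x₃ → length (run A δ (phases x₂ x₃)) ≡ N ℕ.+ (N ℕ.+ N)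
    length-run x₂ x₃ = trans (length-runFrom A δ items estimates [] (arrivals x₂ x₃))
                             (ListP.length-tabulate (λ i → i , byPhase (toℕ i) small x₂ x₃))

    run-agree₁ : ∀ x₂ x₃ x₂′ x₃′ → take N (run A δ (phases x₂ x₃)) ≡ take N (run A δ (phases x₂′ x₃′))
    run-agree₁ x₂ x₃ x₂′ x₃′ = runFrom-take A δ items estimates [] N (arrivals x₂ x₃) (arrivals x₂′ x₃′)
      (take-tabulate N (λ k<N → cong (_ ,_) (byPhase-agree₁ k<N small x₂ x₃ x₂′ x₃′)))

    run-agree₂ : ∀ x₃ x₃′ → take (N ℕ.+ N) (run A δ (phases medium x₃)) ≡ take (N ℕ.+ N) (run A δ (phases medium x₃′))
    run-agree₂ x₃ x₃′ = runFrom-take A δ items estimates [] (N ℕ.+ N) (arrivals medium x₃) (arrivals medium x₃′)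
      (take-tabulate (N ℕ.+ N) (λ k<2N → cong (_ ,_) (byPhase-agree₂ k<2N small medium x₃ x₃′)))

    -- Up to its first N (resp. 2N) items, I₁ (resp. I₂) is indistinguishable from I₃.
    run-lower-bound : Feasible (zip (sizes I₃) (run A δ I₃)) →
      M ℕ.* 15 ℕ.≤ numBins A δ I₁ ℕ.+ (numBins A δ I₂ ℕ.+ numBins A δ I₃)
    run-lower-bound feasible = ℕP.*-cancelˡ-≤ 2 (begin
      2 ℕ.* (M ℕ.* 15)                           ≡⟨ weight-phases M ⟨
      weight N N N                               ≡⟨ cong₂ (λ l₁ l₂ → weight l₁ l₂ N) length₁ length₂ ⟨
      weight (length R₁) (length R₂) N           ≡⟨ cong (weight (length R₁) (length R₂)) length₃ ⟨
      weight (length R₁) (length R₂) (length R₃) ≤⟨ weight≤2*binsOpen R₁ R₂ R₃ bounded ⟩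
      2 ℕ.* binsOpen R₁ R₂ R₃                    ≤⟨ ℕP.*-monoʳ-≤ 2 (ℕP.+-mono-≤ distinct₁ (ℕP.+-mono-≤ distinct₂ distinct₃)) ⟩
      2 ℕ.* (numBins A δ I₁ ℕ.+ (numBins A δ I₂ ℕ.+ numBins A δ I₃)) ∎)
      where
      open ℕP.≤-Reasoning
      R = run A δ I₃
      R₁ = take N R
      R₂ = take N (drop N R)
      R₃ = drop N (drop N R)
      weight-phases : ∀ M → weight (M ℕ.* 6) (M ℕ.* 6) (M ℕ.* 6) ≡ 2 ℕ.* (M ℕ.* 15)
      weight-phases = solve 1 (λ M → M :* con 6 :+ (con 2 :* (M :* con 6) :+ con 2 :* (M :* con 6))
                                     := con 2 :* (M :* con 15)) refl
        where open +-*-Solver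
      length-drop₁ : length (drop N R) ≡ N ℕ.+ N
      length-drop₁ = length-drop-+ N R (length-run medium large)
      length₁ : length R₁ ≡ N
      length₁ = length-take-+ N R (length-run medium large)
      length₂ : length R₂ ≡ N
      length₂ = length-take-+ N (drop N R) length-drop₁
      length₃ : length R₃ ≡ N
      length₃ = length-drop-+ N (drop N R) length-drop₁
      R≡R₁++R₂++R₃ : R ≡ R₁ ++ (R₂ ++ R₃)
      R≡R₁++R₂++R₃ = sym (trans (cong (R₁ ++_) (ListP.take++drop≡id N (drop N R))) (ListP.take++drop≡id N R))
      bounded : EveryBinWeightBounded R₁ R₂ R₃
      bounded b = fits⇒weightBounded (occurrences b R₁) (occurrences b R₂) (occurrences b R₃)
        (phases-fit R₁ R₂ R₃ length₁ length₂ length₃ (subst (λ bs → Feasible (zip (sizes I₃) bs)) R≡R₁++R₂++R₃ feasible) b)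
      distinct₁ : distinct R₁ ℕ.≤ numBins A δ I₁
      distinct₁ = subst (ℕ._≤ numBins A δ I₁) (cong distinct (run-agree₁ _ _ medium large)) (distinct-take N _)
      distinct₂ : distinct (R₁ ++ R₂) ℕ.≤ numBins A δ I₂
      distinct₂ = subst (ℕ._≤ numBins A δ I₂) (cong distinct (trans (run-agree₂ _ large) (take-+ N N R)))
                    (distinct-take (N ℕ.+ N) _)
      distinct₃ : distinct (R₁ ++ (R₂ ++ R₃)) ℕ.≤ numBins A δ I₃
      distinct₃ = ℕP.≤-reflexive (cong distinct (sym R≡R₁++R₂++R₃))

gap : ℚ → ℚ
gap c = toℚ 10 ℚ.* (+ 3 / 2 ℚ.- c)

0<gap : ∀ {c} → c < + 3 / 2 → ℚ.0ℚ < gap c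
0<gap {c} c<3/2 = subst (_< gap c) (ℚP.*-zeroʳ (toℚ 10)) (ℚP.*-monoʳ-<-pos (toℚ 10) {{_}}
  (subst (_< + 3 / 2 ℚ.- c) (ℚP.+-inverseʳ c) (ℚP.+-monoˡ-< (ℚ.- c) c<3/2)))

too-many-bins : ∀ {c K} M {a₁ a₂ a₃} → K ℚ.+ (K ℚ.+ K) < toℚ M ℚ.* gap c →
  M ℕ.* 15 ℕ.≤ a₁ ℕ.+ (a₂ ℕ.+ a₃) → toℚ a₁ ≤ c ℚ.* toℚ M ℚ.+ K → toℚ a₂ ≤ c ℚ.* toℚ (M ℕ.* 3) ℚ.+ K →
  toℚ a₃ ≤ c ℚ.* toℚ (M ℕ.* 6) ℚ.+ K → ⊥
too-many-bins {c} {K} M {a₁} {a₂} {a₃} 3K<gap many bound₁ bound₂ bound₃ = ℚP.<-irrefl refl (begin-strict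
  X ℚ.* toℚ 15                                  ≡⟨ toℚ-* M 15 ⟨
  toℚ (M ℕ.* 15)                                ≤⟨ toℚ-mono-≤ many ⟩
  toℚ (a₁ ℕ.+ (a₂ ℕ.+ a₃))                      ≡⟨ trans (toℚ-+ a₁ _) (cong (toℚ a₁ ℚ.+_) (toℚ-+ a₂ a₃)) ⟩
  toℚ a₁ ℚ.+ (toℚ a₂ ℚ.+ toℚ a₃)                ≤⟨ ℚP.+-mono-≤ bound₁ (ℚP.+-mono-≤ bound₂ bound₃) ⟩
  (c ℚ.* X ℚ.+ K) ℚ.+ ((c ℚ.* toℚ (M ℕ.* 3) ℚ.+ K) ℚ.+ (c ℚ.* toℚ (M ℕ.* 6) ℚ.+ K))
                                                ≡⟨ cong₂ (λ x₃ x₆ → (c ℚ.* X ℚ.+ K) ℚ.+ ((c ℚ.* x₃ ℚ.+ K) ℚ.+ (c ℚ.* x₆ ℚ.+ K)))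
                                                         (toℚ-* M 3) (toℚ-* M 6) ⟩
  (c ℚ.* X ℚ.+ K) ℚ.+ ((c ℚ.* (X ℚ.* toℚ 3) ℚ.+ K) ℚ.+ (c ℚ.* (X ℚ.* toℚ 6) ℚ.+ K))
                                                ≡⟨ collect c X K ⟩
  c ℚ.* (X ℚ.* toℚ 10) ℚ.+ (K ℚ.+ (K ℚ.+ K))    <⟨ ℚP.+-monoʳ-< (c ℚ.* (X ℚ.* toℚ 10)) 3K<gap ⟩
  c ℚ.* (X ℚ.* toℚ 10) ℚ.+ X ℚ.* (toℚ 10 ℚ.* (+ 3 / 2 ℚ.- c)) ≡⟨ cancel c X ⟩
  X ℚ.* toℚ 15                                  ∎)
  where
  open ℚP.≤-Reasoning
  open ℚ-Solver
  X = toℚ M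
  collect : ∀ c X K → (c ℚ.* X ℚ.+ K) ℚ.+ ((c ℚ.* (X ℚ.* toℚ 3) ℚ.+ K) ℚ.+ (c ℚ.* (X ℚ.* toℚ 6) ℚ.+ K))
                      ≡ c ℚ.* (X ℚ.* toℚ 10) ℚ.+ (K ℚ.+ (K ℚ.+ K))
  collect = solve 3 (λ c X K → (c :* X :+ K) :+ ((c :* (X :* con (toℚ 3)) :+ K) :+ (c :* (X :* con (toℚ 6)) :+ K))
                               := c :* (X :* con (toℚ 10)) :+ (K :+ (K :+ K))) refl
  cancel : ∀ c X → c ℚ.* (X ℚ.* toℚ 10) ℚ.+ X ℚ.* (toℚ 10 ℚ.* (+ 3 / 2 ℚ.- c)) ≡ X ℚ.* toℚ 15
  cancel = solve 2 (λ c X → c :* (X :* con (toℚ 10)) :+ X :* (con (toℚ 10) :* (con (+ 3 / 2) :+ (:- c)))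
                            := X :* con (toℚ 15)) refl

⊔0<3/2 : ∀ c → c < + 3 / 2 → c ℚ.⊔ ℚ.0ℚ < + 3 / 2
⊔0<3/2 c c<3/2 with ℚP.⊔-sel c ℚ.0ℚ
... | inj₁ c⊔0≡c = subst (_< + 3 / 2) (sym c⊔0≡c) c<3/2
... | inj₂ c⊔0≡0 = subst (_< + 3 / 2) (sym c⊔0≡0) (ℚP.positive⁻¹ (+ 3 / 2))

theorem2 : (δ : ℚ) → (+ 41 / 43) < δ → δ ≤ 1ℚ →
    (A : OnlineAlg) → (c : ℚ) → c < (+ 3 / 2) → ¬ Competitive δ A c
theorem2 δ 41/43<δ δ≤1 A c c<3/2 (K , competitive) =
  bound I₁ admissible₁ packable₁ λ bound₁ →
  bound I₂ admissible₂ packable₂ λ bound₂ →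
  bound I₃ admissible₃ packable₃ λ bound₃ →
  too-many-bins {c⁺} {K} M {numBins A δ I₁} {numBins A δ I₂} {numBins A δ I₃} (proj₂ M-large)
    (run-lower-bound A (proj₁ (competitive I₃ admissible₃))) bound₁ bound₂ bound₃
  where
  c⁺ : ℚ
  c⁺ = c ℚ.⊔ ℚ.0ℚ
  M-large : Σ ℕ λ M → K ℚ.+ (K ℚ.+ K) < toℚ M ℚ.* gap c⁺
  M-large = archimedean (gap c⁺) (0<gap (⊔0<3/2 c c<3/2)) (K ℚ.+ (K ℚ.+ K))
  M = proj₁ M-large
  open ThreePhase δ 41/43<δ δ≤1 M
  bound : ∀ I → Admissible δ I → ∀ {q} → PackableIn (sizes I) q → ¬ ¬ (toℚ (numBins A δ I) ≤ c⁺ ℚ.* toℚ q ℚ.+ K)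
  bound I admissible = bins-≤-packing {c} {K} {sizes I} {numBins A δ I} (proj₂ (competitive I admissible))
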